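{- Confluence, local confluence, the normal form property and the cofinality property are not first-order definable. More precisely, none of $\mathrm{CR}$, $\mathrm{WCR}$, $\mathrm{NFP}$, $\mathrm{CP}$, $\neg\mathrm{CR}$, $\neg\mathrm{WCR}$, $\neg\mathrm{NFP}$, $\neg\mathrm{CP}$ is a generalised first-order property of abstract rewrite systems.
   Context: An ARS is a pair $(A,\to)$, $A$ non-empty, ${\to}\subseteq A\times A$; $\twoheadrightarrow$ is the reflexive transitive closure and $\leftrightarrow^*$ the reflexive transitive closure of ${\to}\cup{\leftarrow}$. CR (confluence): $a\twoheadrightarrow b$, $a\twoheadrightarrow c$ imply $b\twoheadrightarrow d$, $c\twoheadrightarrow d$ for some $d$. WCR (local confluence): $a\to b$, $a\to c$ imply $b\twoheadrightarrow d$, $c\twoheadrightarrow d$ for some $d$. A normal form is an element with no outgoing step; NFP: for all $a$ and normal forms $b$, $a\leftrightarrow^*b$ implies $a\twoheadrightarrow b$. CP (cofinality property): for every $a\in A$ there is a finite or infinite reduction $a=b_0\to b_1\to\cdots$ such that every $x$ with $a\twoheadrightarrow x$ satisfies $x\twoheadrightarrow b_i$ for some $i$. $\neg P$ is the property of not having $P$. A property $P$ is a generalised first-order property if there is a set $\Phi$ of sentences of first-order logic with equality and a binary predicate symbol $\to$ (interpreted as the one-step relation) such that for every ARS $\mathcal{A}$, $\mathcal{A}$ has $P$ iff $\mathcal{A}\models\Phi$. -}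

module Defs where

open import Level using (0ℓ)
open import Data.Nat using (ℕ; zero; suc; _<_; _≤_)
open import Data.Fin using (Fin)
open import Data.Product using (Σ; _×_; _,_)
open import Data.Sum using (_⊎_)
open import Data.Empty using (⊥)
open import Relation.Nullary using (¬_)
open import Relation.Unary using (Pred)
open import Relation.Binary.PropositionalEquality using (_≡_)
open import Relation.Binary.Construct.Closure.ReflexiveTransitive using (Star)
open import Relation.Binary.Construct.Closure.Symmetric using (SymClosure)
open import Function.Bundles using (_⇔_)

record ARS : Set₁ where
  field
    Carrier  : Set
    inhabit  : Carrier
    _⟶_      : Carrier → Carrier → Set

  _↠_ : Carrier → Carrier → Set
  _↠_ = Star _⟶_

  _↔*_ : Carrier → Carrier → Set
  _↔*_ = Star (SymClosure _⟶_)

  NormalForm : Carrier → Set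
  NormalForm b = ∀ c → ¬ (b ⟶ c)

open ARS public

Property : Set₁
Property = ARS → Set

CR : Property
CR 𝒜 = ∀ a b c → _↠_ 𝒜 a b → _↠_ 𝒜 a c →
       Σ (Carrier 𝒜) λ d → _↠_ 𝒜 b d × _↠_ 𝒜 c d

WCR : Property
WCR 𝒜 = ∀ a b c → _⟶_ 𝒜 a b → _⟶_ 𝒜 a c →
        Σ (Carrier 𝒜) λ d → _↠_ 𝒜 b d × _↠_ 𝒜 c d

NFP : Property
NFP 𝒜 = ∀ a b → NormalForm 𝒜 b → _↔*_ 𝒜 a b → _↠_ 𝒜 a b

CP : Property
CP 𝒜 = ∀ a →
    (Σ ℕ λ n → Σ (ℕ → Carrier 𝒜) λ f →
        f 0 ≡ a
      × (∀ i → i < n → _⟶_ 𝒜 (f i) (f (suc i)))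
      × (∀ x → _↠_ 𝒜 a x → Σ ℕ λ i → i ≤ n × _↠_ 𝒜 x (f i)))
  ⊎ (Σ (ℕ → Carrier 𝒜) λ f →
        f 0 ≡ a
      × (∀ i → _⟶_ 𝒜 (f i) (f (suc i)))
      × (∀ x → _↠_ 𝒜 a x → Σ ℕ λ i → _↠_ 𝒜 x (f i)))

Not : Property → Property
Not P 𝒜 = ¬ P 𝒜

-- First-order logic with equality over the signature {→}
-- (well-scoped de Bruijn variables: Formula n has n free variables)

infixr 5 _⇒_
infixr 6 _∨_
infixr 7 _∧_
data Formula (n : ℕ) : Set where
  _≐_   : Fin n → Fin n → Formula n
  rel   : Fin n → Fin n → Formula n
  ⊥'    : Formula n
  _∧_   : Formula n → Formula n → Formula n
  _∨_   : Formula n → Formula n → Formula n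
  _⇒_   : Formula n → Formula n → Formula n
  ∀'    : Formula (suc n) → Formula n
  ∃'    : Formula (suc n) → Formula n

Sentence : Set
Sentence = Formula 0

extend : {A : Set} {n : ℕ} → (Fin n → A) → A → Fin (suc n) → A
extend ρ a Fin.zero    = a
extend ρ a (Fin.suc i) = ρ i

Sat : (𝒜 : ARS) {n : ℕ} → Formula n → (Fin n → Carrier 𝒜) → Set
Sat 𝒜 (x ≐ y)   ρ = ρ x ≡ ρ y
Sat 𝒜 (rel x y) ρ = _⟶_ 𝒜 (ρ x) (ρ y)
Sat 𝒜 ⊥'        ρ = ⊥
Sat 𝒜 (φ ∧ ψ)   ρ = Sat 𝒜 φ ρ × Sat 𝒜 ψ ρ
Sat 𝒜 (φ ∨ ψ)   ρ = Sat 𝒜 φ ρ ⊎ Sat 𝒜 ψ ρ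
Sat 𝒜 (φ ⇒ ψ)   ρ = Sat 𝒜 φ ρ → Sat 𝒜 ψ ρ
Sat 𝒜 (∀' φ)    ρ = ∀ a → Sat 𝒜 φ (extend ρ a)
Sat 𝒜 (∃' φ)    ρ = Σ (Carrier 𝒜) λ a → Sat 𝒜 φ (extend ρ a)

emptyEnv : {A : Set} → Fin 0 → A
emptyEnv ()

_⊨_ : ARS → Sentence → Set
𝒜 ⊨ φ = Sat 𝒜 φ emptyEnv

_⊨Th_ : ARS → Pred Sentence 0ℓ → Set
𝒜 ⊨Th Φ = ∀ φ → Φ φ → 𝒜 ⊨ φ

GeneralisedFirstOrder : Property → Set₁
GeneralisedFirstOrder P =
  Σ (Pred Sentence 0ℓ) λ Φ → ∀ (𝒜 : ARS) → P 𝒜 ⇔ (𝒜 ⊨Th Φ)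

-- Compare Ray = ℕ with RayAndLine = ℕ ⊎ ℤ, both read as disjoint unions of
-- chains with an origin 0 on the ℕ-chain.  Call two tuples T-similar when they
-- realise the same displacements of size at most T along chains, the origin
-- included.  As in an Ehrenfeucht–Fraïssé game, 3^k-similar tuples satisfy the
-- same formulas of quantifier depth k: a new point near an old one is answered
-- at the same offset from the corresponding old point, a point far from all old
-- ones by a far point (every chain is infinite), and excluded middle decides
-- which case occurs.  Hence Ray and RayAndLine are elementarily equivalent for
-- every step relation fixed by displacements at most 1 between the origin and
-- the two points, in particular for "x → x+1, and the origin → everything" and
-- for "x → x−1, and 1 → everything".  Over Ray the first is cofinal and the
-- second has the normal form property; over RayAndLine the line is entered
-- from the origin (resp. is convertible with the normal form 0) but never left,
-- which breaks WCR and NFP.  A set of sentences cannot separate elementarily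
-- equivalent systems, so it axiomatises neither a property nor its negation.

module Submission where

open import Defs hiding (_⟶_; _↠_)
open import Level using (0ℓ)
open import Algebra.Bundles using (AbelianGroup)
open import Axiom.ExcludedMiddle using (ExcludedMiddle)
open import Data.Bool using (Bool; true; false)
open import Data.Empty using (⊥-elim)
open import Data.Fin using (Fin) renaming (zero to fzero; suc to fsuc)
open import Data.Integer as ℤ using (ℤ; +_; -[1+_]; 0ℤ; 1ℤ; _+_; _-_; -_; ∣_∣; +≤+; +<+; -<+)
import Data.Integer.Properties as ℤP
open import Data.Integer.Tactic.RingSolver using (solve-∀)
open import Data.Nat as ℕ using (ℕ; zero; suc; z≤n; s≤s; _≤_; _<_; _⊔_; _*_; _^_)
import Data.Nat.Properties as ℕP
import Data.Nat.Tactic.RingSolver as ℕSolver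
open import Data.Product using (Σ; _×_; _,_; proj₁; proj₂)
open import Data.Product.Function.NonDependent.Propositional using (_×-⇔_)
open import Data.Sum using (_⊎_; inj₁; inj₂)
open import Data.Sum.Function.Propositional using (_⊎-⇔_)
open import Data.Unit using (⊤; tt)
open import Function using (_∘_)
open import Function.Bundles using (_⇔_; mk⇔; Equivalence)
import Function.Properties.Equivalence as ⇔
open import Function.Related.TypeIsomorphisms using (→-cong-⇔)
open import Relation.Nullary using (¬_; yes; no)
open import Relation.Binary.PropositionalEquality
open import Relation.Binary.Construct.Closure.ReflexiveTransitive using (Star; ε; _◅_; _◅◅_)
open import Relation.Binary.Construct.Closure.Symmetric using (SymClosure; fwd; bwd)
open import Algebra.Properties.Group (AbelianGroup.group ℤP.+-0-abelianGroup)
  using (identityʳ-unique; //-rightDividesʳ)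

open Equivalence using (to; from)

Star-preserves : ∀ {A : Set} {R : A → A → Set} (P : A → Set) →
                 (∀ {x y} → R x y → P x → P y) → ∀ {x y} → Star R x y → P x → P y
Star-preserves P step ε        px = px
Star-preserves P step (r ◅ rs) px = Star-preserves P step rs (step r px)

module _ (𝒜 : ARS) where
  open ARS 𝒜 using (_⟶_; _↠_)

  ↠-to-end : (f : ℕ → Carrier 𝒜) (n : ℕ) → (∀ i → i < n → f i ⟶ f (suc i)) →
             ∀ {i} → i ≤ n → f i ↠ f n
  ↠-to-end f zero    steps z≤n = ε
  ↠-to-end f (suc n) steps i≤1+n with ℕP.m≤n⇒m<n∨m≡n i≤1+n
  ... | inj₁ i<1+n = ↠-to-end f n (λ k k<n → steps k (ℕP.m<n⇒m<1+n k<n)) (ℕ.s≤s⁻¹ i<1+n)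
                     ◅◅ steps n (ℕP.n<1+n n) ◅ ε
  ... | inj₂ refl  = ε

  CP⇒CR : CP 𝒜 → CR 𝒜
  CP⇒CR cp a b c a↠b a↠c with cp a
  ... | inj₁ (n , f , _ , steps , cofinal) =
    let _ , i≤n , b↠fi = cofinal b a↠b
        _ , j≤n , c↠fj = cofinal c a↠c
    in f n , b↠fi ◅◅ ↠-to-end f n steps i≤n , c↠fj ◅◅ ↠-to-end f n steps j≤n
  ... | inj₂ (f , _ , steps , cofinal) =
    let i , b↠fi = cofinal b a↠b
        j , c↠fj = cofinal c a↠c
        to-top : ∀ {k} → k ≤ i ⊔ j → f k ↠ f (i ⊔ j)
        to-top = ↠-to-end f (i ⊔ j) (λ k _ → steps k)
    in f (i ⊔ j) , b↠fi ◅◅ to-top (ℕP.m≤m⊔n i j) , c↠fj ◅◅ to-top (ℕP.m≤n⊔m i j)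

  CR⇒WCR : CR 𝒜 → WCR 𝒜
  CR⇒WCR cr a b c a→b a→c = cr a b c (a→b ◅ ε) (a→c ◅ ε)

ElementarilyEquivalent : ARS → ARS → Set
ElementarilyEquivalent 𝒜 ℬ = ∀ φ → (𝒜 ⊨ φ) ⇔ (ℬ ⊨ φ)

separated⇒¬GFO : ∀ {𝒜 ℬ} (P : Property) → ElementarilyEquivalent 𝒜 ℬ →
                 P 𝒜 → ¬ P ℬ → ¬ GeneralisedFirstOrder P
separated⇒¬GFO P 𝒜≡ℬ p𝒜 ¬pℬ (Φ , defines) =
  ¬pℬ (from (defines _) λ φ φ∈Φ → to (𝒜≡ℬ φ) (to (defines _) p𝒜 φ φ∈Φ))

separated⇒¬GFO-both : ∀ {𝒜 ℬ} (P : Property) → ElementarilyEquivalent 𝒜 ℬ →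
                      P 𝒜 → ¬ P ℬ → ¬ GeneralisedFirstOrder P × ¬ GeneralisedFirstOrder (Not P)
separated⇒¬GFO-both P 𝒜≡ℬ p𝒜 ¬pℬ =
    separated⇒¬GFO P 𝒜≡ℬ p𝒜 ¬pℬ
  , separated⇒¬GFO (Not P) (⇔.sym ∘ 𝒜≡ℬ) ¬pℬ (λ ¬p𝒜 → ¬p𝒜 p𝒜)

∀-⇔-matched : ∀ {A B : Set} {P : A → Set} {Q : B → Set} →
              (∀ a → Σ B λ b → P a ⇔ Q b) → (∀ b → Σ A λ a → P a ⇔ Q b) →
              (∀ a → P a) ⇔ (∀ b → Q b)
∀-⇔-matched forth back = mk⇔
  (λ p b → let a , e = back b  in to e (p a))
  (λ q a → let b , e = forth a in from e (q b))

∃-⇔-matched : ∀ {A B : Set} {P : A → Set} {Q : B → Set} →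
              (∀ a → Σ B λ b → P a ⇔ Q b) → (∀ b → Σ A λ a → P a ⇔ Q b) →
              Σ A P ⇔ Σ B Q
∃-⇔-matched forth back = mk⇔
  (λ (a , p) → let b , e = forth a in b , to e p)
  (λ (b , q) → let a , e = back b  in a , from e q)

bounded : ∀ {m} (f : Fin m → ℕ) → Σ ℕ λ B → ∀ i → f i ≤ B
bounded {zero}  f = 0 , λ ()
bounded {suc m} f =
  let B , f≤B = bounded (f ∘ fsuc)
  in f fzero ⊔ B , λ { fzero → ℕP.m≤m⊔n (f fzero) B
                     ; (fsuc i) → ℕP.≤-trans (f≤B i) (ℕP.m≤n⊔m (f fzero) B) }

underflow-bound : ∀ {p d} → + 0 ℤ.≤ p → p + d ℤ.< 0ℤ → ∣ p ∣ ≤ ∣ d ∣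
underflow-bound {+ m} {+ k}     (+≤+ _) (+<+ ())
underflow-bound {+ m} { -[1+ k ]} (+≤+ _) m-k<0 with ℕP.≤-total m (suc k)
... | inj₁ m≤1+k = m≤1+k
... | inj₂ 1+k≤m with +<+ () ← subst (ℤ._< 0ℤ) (ℤP.⊖-≥ 1+k≤m) m-k<0

-c+[c+f-c′]+c′≡f : ∀ c f c′ → - c + (c + f - c′) + c′ ≡ f
-c+[c+f-c′]+c′≡f = solve-∀

T+T+T≡3*T : ∀ T → T ℕ.+ T ℕ.+ T ≡ 3 * T
T+T+T≡3*T = ℕSolver.solve-∀

-- Each chain is a copy of ℤ, except the origin's, which is a copy of ℕ.
record ChainStructure : Set₁ where
  field
    Point  : Set
    Chain  : Set
    chain  : Point → Chain
    pos    : Point → ℤ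
    origin : Point
    pos-origin          : pos origin ≡ 0ℤ
    chain-pos-injective : ∀ {x y} → chain x ≡ chain y → pos x ≡ pos y → x ≡ y
    origin-chain-nonneg : ∀ {x} → chain origin ≡ chain x → + 0 ℤ.≤ pos x
    translate           : ∀ x d → (Σ Point λ y → chain x ≡ chain y × pos y ≡ pos x + d)
                                ⊎ (chain origin ≡ chain x × pos x + d ℤ.< 0ℤ)

  Dist : Point → Point → ℤ → Set
  Dist x y d = chain x ≡ chain y × pos y ≡ pos x + d

  Dist-cong : ∀ {x y d e} → d ≡ e → Dist x y d → Dist x y e
  Dist-cong refl xy = xy

  Dist-refl : ∀ {x} → Dist x x 0ℤ
  Dist-refl {x} = refl , sym (ℤP.+-identityʳ (pos x))

  Dist-sym : ∀ {x y d} → Dist x y d → Dist y x (- d)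
  Dist-sym {x} {y} {d} (c , p) = sym c , (begin
    pos x            ≡⟨ //-rightDividesʳ d (pos x) ⟨
    pos x + d - d    ≡⟨ cong (_- d) p ⟨
    pos y - d        ∎)
    where open ≡-Reasoning

  Dist-trans : ∀ {x y z d e} → Dist x y d → Dist y z e → Dist x z (d + e)
  Dist-trans {x} {y} {z} {d} {e} (c , p) (c′ , q) = trans c c′ , (begin
    pos z            ≡⟨ q ⟩
    pos y + e        ≡⟨ cong (_+ e) p ⟩
    pos x + d + e    ≡⟨ ℤP.+-assoc (pos x) d e ⟩
    pos x + (d + e)  ∎)
    where open ≡-Reasoning

  Dist-self⇔ : ∀ {x d} → Dist x x d ⇔ d ≡ 0ℤ
  Dist-self⇔ {x} = mk⇔ (λ (_ , p) → identityʳ-unique (pos x) _ (sym p)) (λ { refl → Dist-refl })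

  Dist-0⇔≡ : ∀ {x y} → Dist x y 0ℤ ⇔ x ≡ y
  Dist-0⇔≡ {x} = mk⇔ (λ (c , p) → chain-pos-injective c (sym (trans p (ℤP.+-identityʳ (pos x)))))
                     (λ { refl → Dist-refl })

  Dist-shift : ∀ {x x′ y y′ c c′ f} → Dist x x′ c → Dist y y′ c′ →
               Dist x′ y′ f ⇔ Dist x y (c + f - c′)
  Dist-shift {c = c} {c′} {f} xx′ yy′ = mk⇔
    (λ x′y′ → Dist-trans (Dist-trans xx′ x′y′) (Dist-sym yy′))
    (λ xy → Dist-cong (-c+[c+f-c′]+c′≡f c f c′) (Dist-trans (Dist-trans (Dist-sym xx′) xy) yy′))

  Dist-origin : ∀ {x} → chain origin ≡ chain x → Dist origin x (pos x)
  Dist-origin {x} c = c , sym (trans (cong (_+ pos x) pos-origin) (ℤP.+-identityˡ (pos x)))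

  Dist-origin-nonneg : ∀ {x e} → Dist origin x e → + 0 ℤ.≤ e
  Dist-origin-nonneg {x} {e} (c , p) =
    subst (+ 0 ℤ.≤_) (trans p (trans (cong (_+ e) pos-origin) (ℤP.+-identityˡ e)))
          (origin-chain-nonneg c)

  origin-chain-point : ∀ n → Σ Point λ y → Dist origin y (+ n)
  origin-chain-point n with translate origin (+ n)
  ... | inj₁ found = found
  ... | inj₂ (_ , underflow) with +<+ () ← subst (λ o → o + + n ℤ.< 0ℤ) pos-origin underflow

  withOrigin : ∀ {m} → (Fin m → Point) → Fin (suc m) → Point
  withOrigin ρ = extend ρ origin

  Far : ∀ {m} → ℕ → (Fin m → Point) → Point → Set
  Far T ρ y = ∀ i d → ∣ d ∣ ≤ T → ¬ Dist (ρ i) y d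

  far-point : ∀ {m} (ρ : Fin m → Point) T → Σ Point (Far T ρ)
  far-point ρ T = y , λ i d d≤T ρi→y → ℕP.<-irrefl refl (too-close i d d≤T ρi→y)
    where
    B = proj₁ (bounded (∣_∣ ∘ pos ∘ ρ))
    n = suc (B ℕ.+ T)
    y = proj₁ (origin-chain-point n)
    pos-y : pos y ≡ + n
    pos-y = trans (proj₂ (proj₂ (origin-chain-point n))) (cong (_+ + n) pos-origin)
    too-close : ∀ i d → ∣ d ∣ ≤ T → Dist (ρ i) y d → B ℕ.+ T < B ℕ.+ T
    too-close i d d≤T (_ , p) = begin-strict
      B ℕ.+ T                      <⟨ ℕP.n<1+n _ ⟩
      n                            ≡⟨ cong ∣_∣ pos-y ⟨
      ∣ pos y ∣                    ≡⟨ cong ∣_∣ p ⟩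
      ∣ pos (ρ i) + d ∣            ≤⟨ ℤP.∣i+j∣≤∣i∣+∣j∣ (pos (ρ i)) d ⟩
      ∣ pos (ρ i) ∣ ℕ.+ ∣ d ∣      ≤⟨ ℕP.+-mono-≤ (proj₂ (bounded (∣_∣ ∘ pos ∘ ρ)) i) d≤T ⟩
      B ℕ.+ T                      ∎
      where open ℕP.≤-Reasoning

open ChainStructure using (Point; origin; Dist; withOrigin)

chainARS : (S : ChainStructure) → (Point S → Point S → Set) → ARS
chainARS S R = record { Carrier = Point S ; inhabit = origin S ; _⟶_ = R }

Similar : (S₁ S₂ : ChainStructure) {m : ℕ} → ℕ → (Fin m → Point S₁) → (Fin m → Point S₂) → Set
Similar S₁ S₂ T ρ σ = ∀ i j d → ∣ d ∣ ≤ T → Dist S₁ (ρ i) (ρ j) d ⇔ Dist S₂ (σ i) (σ j) d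

module _ (S₁ S₂ : ChainStructure) where
  private
    module A = ChainStructure S₁
    module B = ChainStructure S₂

  similar-mono : ∀ {m T T′} {ρ : Fin m → A.Point} {σ} →
                 T′ ≤ T → Similar S₁ S₂ T ρ σ → Similar S₁ S₂ T′ ρ σ
  similar-mono T′≤T I i j d d≤T′ = I i j d (ℕP.≤-trans d≤T′ T′≤T)

  similar-sym : ∀ {m T} {ρ : Fin m → A.Point} {σ} → Similar S₁ S₂ T ρ σ → Similar S₂ S₁ T σ ρ
  similar-sym I i j d d≤T = ⇔.sym (I i j d d≤T)

  Dist-self-⇔ : ∀ {x y d} → A.Dist x x d ⇔ B.Dist y y d
  Dist-self-⇔ = ⇔.trans A.Dist-self⇔ (⇔.sym B.Dist-self⇔)

  similar-origins : ∀ T → Similar S₁ S₂ T (A.withOrigin emptyEnv) (B.withOrigin emptyEnv)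
  similar-origins T fzero fzero _ _ = Dist-self-⇔

  Anchored : ∀ {m} → ℕ → (Fin m → A.Point) → (Fin m → B.Point) → A.Point → B.Point → Set
  Anchored C ρ σ a b = Σ (Fin _) λ o → Σ ℤ λ c → ∣ c ∣ ≤ C × A.Dist (ρ o) a c × B.Dist (σ o) b c

  similar-anchored : ∀ {m n C T T′} {ρ : Fin m → A.Point} {σ} {ρ′ : Fin n → A.Point} {σ′} →
                     C ℕ.+ T ℕ.+ C ≤ T′ → Similar S₁ S₂ T′ ρ σ →
                     (∀ p → Anchored C ρ σ (ρ′ p) (σ′ p)) → Similar S₁ S₂ T ρ′ σ′
  similar-anchored {C = C} {T} {T′} bound I anchor p q f f≤T
    with anchor p | anchor q
  ... | o , c , c≤C , ρo→ρ′p , σo→σ′p | o′ , c′ , c′≤C , ρo′→ρ′q , σo′→σ′q =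
    ⇔.trans (A.Dist-shift ρo→ρ′p ρo′→ρ′q)
            (⇔.trans (I o o′ _ shifted≤T′) (⇔.sym (B.Dist-shift σo→σ′p σo′→σ′q)))
    where
    open ℕP.≤-Reasoning
    shifted≤T′ : ∣ c + f - c′ ∣ ≤ T′
    shifted≤T′ = begin
      ∣ c + f - c′ ∣                 ≤⟨ ℤP.∣i+j∣≤∣i∣+∣j∣ (c + f) (- c′) ⟩
      ∣ c + f ∣ ℕ.+ ∣ - c′ ∣         ≡⟨ cong (∣ c + f ∣ ℕ.+_) (ℤP.∣-i∣≡∣i∣ c′) ⟩
      ∣ c + f ∣ ℕ.+ ∣ c′ ∣           ≤⟨ ℕP.+-mono-≤ (ℕP.≤-trans (ℤP.∣i+j∣≤∣i∣+∣j∣ c f)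
                                                                (ℕP.+-mono-≤ c≤C f≤T)) c′≤C ⟩
      C ℕ.+ T ℕ.+ C                  ≤⟨ bound ⟩
      T′                             ∎

  module _ {n T : ℕ} {ρ : Fin n → A.Point} {σ : Fin n → B.Point} where

    similar-extend-near : ∀ {i d a b} → Similar S₁ S₂ (3 * T) (A.withOrigin ρ) (B.withOrigin σ) →
                          ∣ d ∣ ≤ T → A.Dist (A.withOrigin ρ i) a d →
                          B.Dist (B.withOrigin σ i) b d →
                          Similar S₁ S₂ T (A.withOrigin (extend ρ a)) (B.withOrigin (extend σ b))
    similar-extend-near {i} {d} I d≤T ρi→a σi→b =
      similar-anchored (ℕP.≤-reflexive (T+T+T≡3*T T)) I anchor
      where
      anchor : ∀ p → Anchored T (A.withOrigin ρ) (B.withOrigin σ)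
                                (A.withOrigin (extend ρ _) p) (B.withOrigin (extend σ _) p)
      anchor fzero               = fzero , 0ℤ , z≤n , A.Dist-refl , B.Dist-refl
      anchor (fsuc fzero)        = i , d , d≤T , ρi→a , σi→b
      anchor (fsuc (fsuc j))     = fsuc j , 0ℤ , z≤n , A.Dist-refl , B.Dist-refl

    similar-extend-far : ∀ {a b} → Similar S₁ S₂ T (A.withOrigin ρ) (B.withOrigin σ) →
                         A.Far T (A.withOrigin ρ) a → B.Far T (B.withOrigin σ) b →
                         Similar S₁ S₂ T (A.withOrigin (extend ρ a)) (B.withOrigin (extend σ b))
    similar-extend-far {a} {b} I a-far b-far = similar
      where
      into : ∀ i f → ∣ f ∣ ≤ T → A.Dist (A.withOrigin ρ i) a f ⇔ B.Dist (B.withOrigin σ i) b f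
      into i f f≤T = mk⇔ (⊥-elim ∘ a-far i f f≤T) (⊥-elim ∘ b-far i f f≤T)
      out-of : ∀ i f → ∣ f ∣ ≤ T → A.Dist a (A.withOrigin ρ i) f ⇔ B.Dist b (B.withOrigin σ i) f
      out-of i f f≤T = mk⇔ (⊥-elim ∘ a-far i (- f) -f≤T ∘ A.Dist-sym)
                           (⊥-elim ∘ b-far i (- f) -f≤T ∘ B.Dist-sym)
        where -f≤T = subst (_≤ T) (sym (ℤP.∣-i∣≡∣i∣ f)) f≤T
      similar : Similar S₁ S₂ T (A.withOrigin (extend ρ a)) (B.withOrigin (extend σ b))
      similar fzero           fzero           = I fzero fzero
      similar fzero           (fsuc fzero)    = into fzero
      similar fzero           (fsuc (fsuc j)) = I fzero (fsuc j)
      similar (fsuc fzero)    fzero           = out-of fzero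
      similar (fsuc fzero)    (fsuc fzero)    = λ _ _ → Dist-self-⇔
      similar (fsuc fzero)    (fsuc (fsuc j)) = out-of (fsuc j)
      similar (fsuc (fsuc i)) fzero           = I (fsuc i) fzero
      similar (fsuc (fsuc i)) (fsuc fzero)    = into (fsuc i)
      similar (fsuc (fsuc i)) (fsuc (fsuc j)) = I (fsuc i) (fsuc j)

    -- The answer cannot fall off the origin's ℕ-chain: it would then lie within
    -- distance T of the origin, and similarity would carry that back to a.
    counterpart : ∀ {i d a} → Similar S₁ S₂ T (A.withOrigin ρ) (B.withOrigin σ) →
                  ∣ d ∣ ≤ T → A.Dist (A.withOrigin ρ i) a d →
                  Σ B.Point λ b → B.Dist (B.withOrigin σ i) b d
    counterpart {i} {d} I d≤T ρi→a with B.translate (B.withOrigin σ i) d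
    ... | inj₁ found = found
    ... | inj₂ (on-origin-chain , underflow) =
      ⊥-elim (ℤP.<⇒≱ underflow (A.Dist-origin-nonneg (A.Dist-trans origin→ρi ρi→a)))
      where
      p≥0       = B.origin-chain-nonneg on-origin-chain
      origin→ρi = from (I fzero i _ (ℕP.≤-trans (underflow-bound p≥0 underflow) d≤T))
                       (B.Dist-origin on-origin-chain)

  forth : ExcludedMiddle 0ℓ → ∀ {n} T (ρ : Fin n → A.Point) (σ : Fin n → B.Point) →
          Similar S₁ S₂ (3 * T) (A.withOrigin ρ) (B.withOrigin σ) → ∀ a →
          Σ B.Point λ b → Similar S₁ S₂ T (A.withOrigin (extend ρ a)) (B.withOrigin (extend σ b))
  forth em T ρ σ I a
    with em {Σ (Fin _) λ i → Σ ℤ λ d → ∣ d ∣ ≤ T × A.Dist (A.withOrigin ρ i) a d}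
  ... | yes (i , d , d≤T , ρi→a) =
    let b , σi→b = counterpart {i = i} (similar-mono (ℕP.m≤n*m T 3) I) d≤T ρi→a
    in b , similar-extend-near {i = i} I d≤T ρi→a σi→b
  ... | no ¬near =
    let b , b-far = B.far-point (B.withOrigin σ) T
    in b , similar-extend-far (similar-mono (ℕP.m≤n*m T 3) I)
                              (λ i d d≤T ρi→a → ¬near (i , d , d≤T , ρi→a)) b-far

depth : ∀ {n} → Formula n → ℕ
depth (_ ≐ _)   = 0
depth (rel _ _) = 0
depth ⊥'        = 0
depth (φ ∧ ψ)   = depth φ ⊔ depth ψ
depth (φ ∨ ψ)   = depth φ ⊔ depth ψ
depth (φ ⇒ ψ)   = depth φ ⊔ depth ψ
depth (∀' φ)    = suc (depth φ)
depth (∃' φ)    = suc (depth φ)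

ChainRelation : Set₁
ChainRelation = (S : ChainStructure) → Point S → Point S → Set

SimilarityInvariant : ChainRelation → Set₁
SimilarityInvariant R = ∀ S₁ S₂ {n} (ρ : Fin n → Point S₁) σ →
  Similar S₁ S₂ 1 (withOrigin S₁ ρ) (withOrigin S₂ σ) → ∀ x y → R S₁ (ρ x) (ρ y) ⇔ R S₂ (σ x) (σ y)

module _ (em : ExcludedMiddle 0ℓ) (R : ChainRelation) (R-invariant : SimilarityInvariant R)
         (S₁ S₂ : ChainStructure) where
  private
    𝒜₁ = chainARS S₁ (R S₁)
    𝒜₂ = chainARS S₂ (R S₂)

  mutual
    sat-⇔ : ∀ {n} (φ : Formula n) k → depth φ ≤ k → ∀ ρ σ →
            Similar S₁ S₂ (3 ^ k) (withOrigin S₁ ρ) (withOrigin S₂ σ) →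
            Sat 𝒜₁ φ ρ ⇔ Sat 𝒜₂ φ σ
    sat-⇔ (x ≐ y)   k _ ρ σ I =
      ⇔.trans (⇔.sym (ChainStructure.Dist-0⇔≡ S₁))
              (⇔.trans (I (fsuc x) (fsuc y) 0ℤ z≤n) (ChainStructure.Dist-0⇔≡ S₂))
    sat-⇔ (rel x y) k _ ρ σ I = R-invariant S₁ S₂ ρ σ (similar-mono S₁ S₂ (ℕP.m^n>0 3 k) I) x y
    sat-⇔ ⊥'        k _ ρ σ I = ⇔.refl
    sat-⇔ (φ ∧ ψ)   k h ρ σ I = sat-⇔ φ k (ℕP.m⊔n≤o⇒m≤o _ _ h) ρ σ I
                             ×-⇔ sat-⇔ ψ k (ℕP.m⊔n≤o⇒n≤o _ _ h) ρ σ I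
    sat-⇔ (φ ∨ ψ)   k h ρ σ I = sat-⇔ φ k (ℕP.m⊔n≤o⇒m≤o _ _ h) ρ σ I
                             ⊎-⇔ sat-⇔ ψ k (ℕP.m⊔n≤o⇒n≤o _ _ h) ρ σ I
    sat-⇔ (φ ⇒ ψ)   k h ρ σ I = →-cong-⇔ (sat-⇔ φ k (ℕP.m⊔n≤o⇒m≤o _ _ h) ρ σ I)
                                          (sat-⇔ ψ k (ℕP.m⊔n≤o⇒n≤o _ _ h) ρ σ I)
    sat-⇔ (∀' φ) (suc k) (s≤s h) ρ σ I =
      ∀-⇔-matched (match-forth φ k h ρ σ I) (match-back φ k h ρ σ I)
    sat-⇔ (∃' φ) (suc k) (s≤s h) ρ σ I =
      ∃-⇔-matched (match-forth φ k h ρ σ I) (match-back φ k h ρ σ I)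

    match-forth : ∀ {n} (φ : Formula (suc n)) k → depth φ ≤ k → ∀ ρ σ →
                     Similar S₁ S₂ (3 * 3 ^ k) (withOrigin S₁ ρ) (withOrigin S₂ σ) →
                     ∀ a → Σ (Point S₂) λ b → Sat 𝒜₁ φ (extend ρ a) ⇔ Sat 𝒜₂ φ (extend σ b)
    match-forth φ k h ρ σ I a =
      let b , J = forth S₁ S₂ em (3 ^ k) ρ σ I a
      in b , sat-⇔ φ k h (extend ρ a) (extend σ b) J

    match-back : ∀ {n} (φ : Formula (suc n)) k → depth φ ≤ k → ∀ ρ σ →
                     Similar S₁ S₂ (3 * 3 ^ k) (withOrigin S₁ ρ) (withOrigin S₂ σ) →
                     ∀ b → Σ (Point S₁) λ a → Sat 𝒜₁ φ (extend ρ a) ⇔ Sat 𝒜₂ φ (extend σ b)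
    match-back φ k h ρ σ I b =
      let a , J = forth S₂ S₁ em (3 ^ k) σ ρ (similar-sym S₁ S₂ I) b
      in a , sat-⇔ φ k h (extend ρ a) (extend σ b) (similar-sym S₂ S₁ J)

  chainARS-≡ᴱ : ElementarilyEquivalent 𝒜₁ 𝒜₂
  chainARS-≡ᴱ φ = sat-⇔ φ (depth φ) ℕP.≤-refl emptyEnv emptyEnv (similar-origins S₁ S₂ _)

Advance : ChainRelation
Advance S x y = Dist S x y 1ℤ ⊎ Dist S (origin S) x 0ℤ

Retreat : ChainRelation
Retreat S x y = Dist S y x 1ℤ ⊎ Dist S (origin S) x 1ℤ

advanceARS retreatARS : ChainStructure → ARS
advanceARS S = chainARS S (Advance S)
retreatARS S = chainARS S (Retreat S)

advance-invariant : SimilarityInvariant Advance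
advance-invariant S₁ S₂ ρ σ I x y =
  I (fsuc x) (fsuc y) 1ℤ (s≤s z≤n) ⊎-⇔ I fzero (fsuc x) 0ℤ z≤n

retreat-invariant : SimilarityInvariant Retreat
retreat-invariant S₁ S₂ ρ σ I x y =
  I (fsuc y) (fsuc x) 1ℤ (s≤s z≤n) ⊎-⇔ I fzero (fsuc x) 1ℤ (s≤s z≤n)

ℕ-translate : ∀ x d → (Σ ℕ λ y → + y ≡ + x + d) ⊎ (+ x + d ℤ.< 0ℤ)
ℕ-translate x d with + x + d
... | + y      = inj₁ (y , refl)
... | -[1+ k ] = inj₂ -<+

Ray : ChainStructure
Ray = record
  { Point = ℕ ; Chain = ⊤ ; chain = λ _ → tt ; pos = +_ ; origin = 0
  ; pos-origin          = refl
  ; chain-pos-injective = λ _ → ℤP.+-injective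
  ; origin-chain-nonneg = λ _ → +≤+ z≤n
  ; translate           = λ x d → on-ray {x} {d} (ℕ-translate x d)
  }
  where
  on-ray : ∀ {x d} → (Σ ℕ λ y → + y ≡ + x + d) ⊎ (+ x + d ℤ.< 0ℤ) →
           (Σ ℕ λ y → tt ≡ tt × + y ≡ + x + d) ⊎ (tt ≡ tt × + x + d ℤ.< 0ℤ)
  on-ray (inj₁ (y , p)) = inj₁ (y , refl , p)
  on-ray (inj₂ under)   = inj₂ (refl , under)

onRay : ℕ ⊎ ℤ → Bool
onRay (inj₁ _) = true
onRay (inj₂ _) = false

position : ℕ ⊎ ℤ → ℤ
position (inj₁ n) = + n
position (inj₂ z) = z

RayAndLine : ChainStructure
RayAndLine = record
  { Point = ℕ ⊎ ℤ ; Chain = Bool ; chain = onRay ; pos = position ; origin = inj₁ 0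
  ; pos-origin          = refl
  ; chain-pos-injective = injective
  ; origin-chain-nonneg = nonneg
  ; translate           = translate
  }
  where
  injective : ∀ {x y} → onRay x ≡ onRay y → position x ≡ position y → x ≡ y
  injective {inj₁ _} {inj₁ _} _ p = cong inj₁ (ℤP.+-injective p)
  injective {inj₂ _} {inj₂ _} _ p = cong inj₂ p
  nonneg : ∀ {x} → true ≡ onRay x → + 0 ℤ.≤ position x
  nonneg {inj₁ _} _ = +≤+ z≤n
  translate : ∀ x d → (Σ (ℕ ⊎ ℤ) λ y → onRay x ≡ onRay y × position y ≡ position x + d)
                    ⊎ (true ≡ onRay x × position x + d ℤ.< 0ℤ)
  translate (inj₂ z) d = inj₁ (inj₂ (z + d) , refl , refl)
  translate (inj₁ x) d with ℕ-translate x d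
  ... | inj₁ (y , p) = inj₁ (inj₁ y , refl , p)
  ... | inj₂ under   = inj₂ (refl , under)

ray-succ : ∀ n → Dist Ray n (suc n) 1ℤ
ray-succ n = refl , cong +_ (ℕP.+-comm 1 n)

ray-CP : CP (advanceARS Ray)
ray-CP a = inj₂ ((λ i → i ℕ.+ a) , refl , (λ i → inj₁ (ray-succ (i ℕ.+ a))) ,
                 λ x _ → x , subst (Star (Advance Ray) x) (ℕP.+-comm a x) (climb a x))
  where
  climb : ∀ k x → Star (Advance Ray) x (k ℕ.+ x)
  climb zero    x = ε
  climb (suc k) x = climb k x ◅◅ inj₁ (ray-succ (k ℕ.+ x)) ◅ ε

ray-NFP : NFP (retreatARS Ray)
ray-NFP a zero    _  _ = descend a
  where
  descend : ∀ a → Star (Retreat Ray) a 0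
  descend zero    = ε
  descend (suc n) = inj₁ (ray-succ n) ◅ descend n
ray-NFP a (suc n) nf _ = ⊥-elim (nf n (inj₁ (ray-succ n)))

OnLine : ℕ ⊎ ℤ → Set
OnLine x = onRay x ≡ false

advance-stays-on-line : ∀ {x y} → Advance RayAndLine x y → OnLine x → OnLine y
advance-stays-on-line (inj₁ (c , _)) x-on-line = trans (sym c) x-on-line
advance-stays-on-line (inj₂ (c , _)) x-on-line with () ← trans c x-on-line

retreat-stays-on-line : ∀ {x y} → Retreat RayAndLine x y → OnLine x → OnLine y
retreat-stays-on-line (inj₁ (c , _)) x-on-line = trans c x-on-line
retreat-stays-on-line (inj₂ (c , _)) x-on-line with () ← trans c x-on-line

PositiveOnRay : ℕ ⊎ ℤ → Set
PositiveOnRay x = Σ ℕ λ n → x ≡ inj₁ (suc n)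

advance-stays-positive : ∀ {x y} → Advance RayAndLine x y → PositiveOnRay x → PositiveOnRay y
advance-stays-positive {y = inj₁ _} (inj₁ (_ , p))  (n , refl) =
  n ℕ.+ 1 , cong inj₁ (ℤP.+-injective p)
advance-stays-positive {y = inj₂ _} (inj₁ (() , _)) (n , refl)
advance-stays-positive              (inj₂ (_ , ())) (n , refl)

rayAndLine-¬WCR : ¬ WCR (advanceARS RayAndLine)
rayAndLine-¬WCR wcr
  with wcr (inj₁ 0) (inj₁ 1) (inj₂ 0ℤ) (inj₁ (refl , refl)) (inj₂ (refl , refl))
... | d , 1↠d , line↠d
  with Star-preserves PositiveOnRay advance-stays-positive 1↠d (0 , refl)
     | Star-preserves OnLine advance-stays-on-line line↠d refl
... | _ , refl | ()

0-normal : ∀ y → ¬ Retreat RayAndLine (inj₁ 0) y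
0-normal (inj₁ zero)    (inj₁ (_ , ()))
0-normal (inj₁ (suc _)) (inj₁ (_ , ()))
0-normal (inj₂ _)       (inj₁ (() , _))
0-normal _              (inj₂ (_ , ()))

line↔0 : Star (SymClosure (Retreat RayAndLine)) (inj₂ 0ℤ) (inj₁ 0)
line↔0 = bwd {b = inj₁ 1} (inj₂ (refl , refl)) ◅ fwd (inj₁ (refl , refl)) ◅ ε

rayAndLine-¬NFP : ¬ NFP (retreatARS RayAndLine)
rayAndLine-¬NFP nfp
  with () ← Star-preserves OnLine retreat-stays-on-line
               (nfp (inj₂ 0ℤ) (inj₁ 0) 0-normal line↔0) refl

theorem3p16 : ExcludedMiddle 0ℓ →
    ¬ GeneralisedFirstOrder CR
    × ¬ GeneralisedFirstOrder WCR
    × ¬ GeneralisedFirstOrder NFP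
    × ¬ GeneralisedFirstOrder CP
    × ¬ GeneralisedFirstOrder (Not CR)
    × ¬ GeneralisedFirstOrder (Not WCR)
    × ¬ GeneralisedFirstOrder (Not NFP)
    × ¬ GeneralisedFirstOrder (Not CP)
theorem3p16 em =
    proj₁ cr , proj₁ wcr , proj₁ nfp , proj₁ cp
  , proj₂ cr , proj₂ wcr , proj₂ nfp , proj₂ cp
  where
  ray-CR = CP⇒CR (advanceARS Ray) ray-CP
  rayAndLine-¬CR = rayAndLine-¬WCR ∘ CR⇒WCR (advanceARS RayAndLine)
  advance-≡ᴱ = chainARS-≡ᴱ em Advance advance-invariant Ray RayAndLine
  retreat-≡ᴱ = chainARS-≡ᴱ em Retreat retreat-invariant Ray RayAndLine
  cr  = separated⇒¬GFO-both CR  advance-≡ᴱ ray-CR rayAndLine-¬CR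
  wcr = separated⇒¬GFO-both WCR advance-≡ᴱ (CR⇒WCR (advanceARS Ray) ray-CR) rayAndLine-¬WCR
  cp  = separated⇒¬GFO-both CP  advance-≡ᴱ ray-CP (rayAndLine-¬CR ∘ CP⇒CR (advanceARS RayAndLine))
  nfp = separated⇒¬GFO-both NFP retreat-≡ᴱ ray-NFP rayAndLine-¬NFP
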